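{- Let $p$ be a prime and $n\in\mathbb{Z}_{\ge1}$. Then, in $\mathbb{Z}[x,z]$, \[ \sum_{k = 0}^{np-1} (xz)^{k} \prod_{j = k+1}^{np-1} (1-jz) \equiv \sum_{k = 0}^{np-1} (xz)^{np-k-1} \prod_{j = 1}^{k} (1+jz) \pmod{p}, \] i.e. the two polynomials have congruent coefficients modulo $p$. -}

module Defs where

open import Data.Nat as ℕ using (ℕ; zero; suc; _∸_)
open import Data.Integer as ℤ using (ℤ; +_)

-- Elements of ℤ[x,z] represented by their coefficient functions:
-- f a b = coefficient of x^a z^b.  Everything built below has finite
-- support, so these are genuinely polynomials in ℤ[x,z].
Poly : Set
Poly = ℕ → ℕ → ℤ

sumTo : ℕ → (ℕ → ℤ) → ℤ
sumTo zero    h = h 0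
sumTo (suc n) h = sumTo n h ℤ.+ h (suc n)

cst : ℤ → Poly
cst c zero zero = c
cst c _    _    = + 0

X : Poly
X 1 0 = + 1
X _ _ = + 0

Z : Poly
Z 0 1 = + 1
Z _ _ = + 0

_⊕_ : Poly → Poly → Poly
(f ⊕ g) a b = f a b ℤ.+ g a b

_⊖_ : Poly → Poly → Poly
(f ⊖ g) a b = f a b ℤ.- g a b

_⊗_ : Poly → Poly → Poly
(f ⊗ g) a b = sumTo a (λ i → sumTo b (λ j → f i j ℤ.* g (a ∸ i) (b ∸ j)))

infixl 6 _⊕_ _⊖_
infixl 7 _⊗_

pow : Poly → ℕ → Poly
pow f zero    = cst (+ 1)
pow f (suc k) = f ⊗ pow f k

sumBelow : ℕ → (ℕ → Poly) → Poly
sumBelow zero    F = cst (+ 0)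
sumBelow (suc m) F = sumBelow m F ⊕ F m

-- ∏_{j=lo}^{lo+c-1} F j  (c factors; empty product = 1)
prodFrom : ℕ → ℕ → (ℕ → Poly) → Poly
prodFrom lo zero    F = cst (+ 1)
prodFrom lo (suc c) F = F lo ⊗ prodFrom (suc lo) c F

lhsPoly : ℕ → Poly
lhsPoly N = sumBelow N (λ k →
  pow (X ⊗ Z) k ⊗ prodFrom (suc k) (N ∸ suc k) (λ j → cst (+ 1) ⊖ cst (+ j) ⊗ Z))

rhsPoly : ℕ → Poly
rhsPoly N = sumBelow N (λ k →
  pow (X ⊗ Z) (N ∸ k ∸ 1) ⊗ prodFrom 1 k (λ j → cst (+ 1) ⊕ cst (+ j) ⊗ Z))

{-# OPTIONS --safe #-}
-- Put N = n p.  Since p ∣ N, the factor 1 - j z is congruent mod p to 1 + (N - j) z, so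
-- ∏_{j=k+1}^{N-1} (1 - j z) is congruent to ∏_{i=1}^{N-k-1} (1 + i z) taken in reverse
-- order; both are generating functions of elementary symmetric polynomials, which do not
-- depend on the order of the factors.  Substituting k ↦ N - 1 - k in the left sum then
-- gives the right sum.
module Submission where

open import Defs
open import Data.Nat using (ℕ; _*_; _≤_)
open import Data.Nat.Primality using (Prime)
open import Data.Integer using (+_; _-_)
open import Data.Integer.Divisibility using (_∣_)

open import Data.Nat as ℕ using (zero; suc; _∸_; _<_)
import Data.Nat.Properties as ℕ
import Data.Nat.Divisibility as ℕ
open import Data.Integer using (ℤ; -_) renaming (_+_ to _+ℤ_; _*_ to _*ℤ_)
import Data.Integer.Properties as ℤ
import Data.Integer.Divisibility.Signed as Signed
open import Data.Integer.Tactic.RingSolver using (solve-∀)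
open import Data.List using (List; []; _∷_; map; _∷ʳ_; reverse; applyDownFrom)
import Data.List.Properties as List
open import Data.List.Relation.Binary.Pointwise using (Pointwise; []; _∷_)
open import Function using (_∘_)
open import Relation.Binary.PropositionalEquality

infix 4 _≐_
_≐_ : Poly → Poly → Set
f ≐ g = ∀ a b → f a b ≡ g a b

sumTo-cong : ∀ n {h h′ : ℕ → ℤ} → h ≗ h′ → sumTo n h ≡ sumTo n h′
sumTo-cong zero    eq = eq 0
sumTo-cong (suc n) eq = cong₂ _+ℤ_ (sumTo-cong n eq) (eq (suc n))

sumTo-0 : ∀ n {h : ℕ → ℤ} → (∀ i → h i ≡ + 0) → sumTo n h ≡ + 0
sumTo-0 zero    eq = eq 0
sumTo-0 (suc n) eq = cong₂ _+ℤ_ (sumTo-0 n eq) (eq (suc n))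

sumTo-unfoldˡ : ∀ n (h : ℕ → ℤ) → sumTo (suc n) h ≡ h 0 +ℤ sumTo n (h ∘ suc)
sumTo-unfoldˡ zero    h = refl
sumTo-unfoldˡ (suc n) h =
  trans (cong (_+ℤ h (suc (suc n))) (sumTo-unfoldˡ n h)) (ℤ.+-assoc (h 0) _ _)

sumTo-head : ∀ n {h : ℕ → ℤ} → (∀ i → h (suc i) ≡ + 0) → sumTo n h ≡ h 0
sumTo-head zero    eq = refl
sumTo-head (suc n) {h} eq = begin
  sumTo (suc n) h            ≡⟨ sumTo-unfoldˡ n h ⟩
  h 0 +ℤ sumTo n (h ∘ suc)   ≡⟨ cong (h 0 +ℤ_) (sumTo-0 n eq) ⟩
  h 0 +ℤ + 0                 ≡⟨ ℤ.+-identityʳ (h 0) ⟩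
  h 0                        ∎
  where open ≡-Reasoning

⊗-cong : ∀ {f f′ g g′ : Poly} → f ≐ f′ → g ≐ g′ → f ⊗ g ≐ f′ ⊗ g′
⊗-cong f≐f′ g≐g′ a b = sumTo-cong a λ i → sumTo-cong b λ j →
  cong₂ _*ℤ_ (f≐f′ i j) (g≐g′ (a ∸ i) (b ∸ j))

cst-⊗ : ∀ c (g : Poly) → cst c ⊗ g ≐ λ a b → c *ℤ g a b
cst-⊗ c g a b =
  trans (sumTo-head a λ i → sumTo-0 b λ j → refl) (sumTo-head b λ j → refl)

sumBelow-cong : ∀ m {F G : ℕ → Poly} → (∀ k → k < m → F k ≐ G k) →
  sumBelow m F ≐ sumBelow m G
sumBelow-cong zero    F≐G a b = refl
sumBelow-cong (suc m) F≐G a b = cong₂ _+ℤ_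
  (sumBelow-cong m (λ k k<m → F≐G k (ℕ.m<n⇒m<1+n k<m)) a b) (F≐G m ℕ.≤-refl a b)

sumBelow-unfoldˡ : ∀ m (F : ℕ → Poly) → sumBelow (suc m) F ≐ F 0 ⊕ sumBelow m (F ∘ suc)
sumBelow-unfoldˡ zero    F a b = ℤ.+-comm (cst (+ 0) a b) (F 0 a b)
sumBelow-unfoldˡ (suc m) F a b =
  trans (cong (_+ℤ F (suc m) a b) (sumBelow-unfoldˡ m F a b)) (ℤ.+-assoc (F 0 a b) _ _)

sumBelow-reverse : ∀ m (F : ℕ → Poly) → sumBelow m F ≐ sumBelow m (λ k → F (m ∸ suc k))
sumBelow-reverse zero    F a b = refl
sumBelow-reverse (suc m) F a b = begin
  sumBelow (suc m) F a b                       ≡⟨ sumBelow-unfoldˡ m F a b ⟩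
  F 0 a b +ℤ sumBelow m (F ∘ suc) a b          ≡⟨ cong (F 0 a b +ℤ_) reversed ⟩
  F 0 a b +ℤ sumBelow m F′ a b                 ≡⟨ ℤ.+-comm (F 0 a b) _ ⟩
  sumBelow m F′ a b +ℤ F 0 a b                 ≡⟨ cong (λ i → sumBelow m F′ a b +ℤ F i a b)
                                                       (sym (ℕ.n∸n≡0 m)) ⟩
  sumBelow (suc m) (λ k → F (m ∸ k)) a b       ∎
  where
  open ≡-Reasoning
  F′ : ℕ → Poly
  F′ k = F (m ∸ k)
  reversed : sumBelow m (F ∘ suc) a b ≡ sumBelow m F′ a b
  reversed = trans (sumBelow-reverse m (F ∘ suc) a b)
    (sumBelow-cong m (λ k k<m a b → cong (λ i → F i a b) (sym (ℕ.+-∸-assoc 1 k<m))) a b)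

linear : ℤ → Poly
linear d zero zero       = + 1
linear d zero (suc zero) = d
linear d _    _          = + 0

1+dz≐linear : ∀ d → cst (+ 1) ⊕ cst d ⊗ Z ≐ linear d
1+dz≐linear d a b = trans (cong (cst (+ 1) a b +ℤ_) (cst-⊗ d Z a b)) (coefficient a b)
  where
  coefficient : ∀ a b → cst (+ 1) a b +ℤ d *ℤ Z a b ≡ linear d a b
  coefficient zero    zero          = cong ((+ 1) +ℤ_) (ℤ.*-zeroʳ d)
  coefficient zero    (suc zero)    = trans (ℤ.+-identityˡ _) (ℤ.*-identityʳ d)
  coefficient zero    (suc (suc b)) = trans (ℤ.+-identityˡ _) (ℤ.*-zeroʳ d)
  coefficient (suc a) b             = trans (ℤ.+-identityˡ _) (ℤ.*-zeroʳ d)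

1-dz≐linear : ∀ d → cst (+ 1) ⊖ cst d ⊗ Z ≐ linear (- d)
1-dz≐linear d a b = trans (cong (λ t → cst (+ 1) a b - t) (cst-⊗ d Z a b)) (coefficient a b)
  where
  coefficient : ∀ a b → cst (+ 1) a b - d *ℤ Z a b ≡ linear (- d) a b
  coefficient zero    zero          = cong (λ t → + 1 - t) (ℤ.*-zeroʳ d)
  coefficient zero    (suc zero)    =
    trans (cong (λ t → + 0 - t) (ℤ.*-identityʳ d)) (ℤ.+-identityˡ _)
  coefficient zero    (suc (suc b)) = cong (λ t → + 0 - t) (ℤ.*-zeroʳ d)
  coefficient (suc a) b             = cong (λ t → + 0 - t) (ℤ.*-zeroʳ d)

zShift : ℤ → Poly → Poly
zShift d Q a zero    = + 0
zShift d Q a (suc b) = d *ℤ Q a b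

linear-⊗ : ∀ d (Q : Poly) → linear d ⊗ Q ≐ Q ⊕ zShift d Q
linear-⊗ d Q a b = trans (sumTo-head a λ i → sumTo-0 b λ j → refl) (coefficient b)
  where
  coefficient : ∀ b →
    sumTo b (λ j → linear d 0 j *ℤ Q a (b ∸ j)) ≡ Q a b +ℤ zShift d Q a b
  coefficient zero    = trans (ℤ.*-identityˡ (Q a 0)) (sym (ℤ.+-identityʳ _))
  coefficient (suc b) = trans (sumTo-unfoldˡ b _)
    (cong₂ _+ℤ_ (ℤ.*-identityˡ (Q a (suc b))) (sumTo-head b λ j → refl))

zPoly : (ℕ → ℤ) → Poly
zPoly e zero    b = e b
zPoly e (suc a) b = + 0

-- ∏_{x ∈ xs} (1 + x z) = Σ_b elemSym xs b z^b
elemSym : List ℤ → ℕ → ℤ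
elemSym []       zero    = + 1
elemSym []       (suc b) = + 0
elemSym (x ∷ xs) zero    = elemSym xs zero
elemSym (x ∷ xs) (suc b) = elemSym xs (suc b) +ℤ x *ℤ elemSym xs b

range : ℕ → ℕ → List ℕ
range lo zero    = []
range lo (suc c) = lo ∷ range (suc lo) c

prodFrom-linear : ∀ (F : ℕ → Poly) (d : ℕ → ℤ) → (∀ j → F j ≐ linear (d j)) →
  ∀ lo c → prodFrom lo c F ≐ zPoly (elemSym (map d (range lo c)))
prodFrom-linear F d F≐linear lo zero    zero    zero    = refl
prodFrom-linear F d F≐linear lo zero    zero    (suc b) = refl
prodFrom-linear F d F≐linear lo zero    (suc a) b       = refl
prodFrom-linear F d F≐linear lo (suc c) a       b       = begin
  (F lo ⊗ prodFrom (suc lo) c F) a b        ≡⟨ ⊗-cong (F≐linear lo) tail≐ a b ⟩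
  (linear (d lo) ⊗ zPoly e) a b             ≡⟨ linear-⊗ (d lo) (zPoly e) a b ⟩
  (zPoly e ⊕ zShift (d lo) (zPoly e)) a b   ≡⟨ coefficient a b ⟩
  zPoly (elemSym (d lo ∷ xs)) a b           ∎
  where
  open ≡-Reasoning
  xs = map d (range (suc lo) c)
  e = elemSym xs
  tail≐ : prodFrom (suc lo) c F ≐ zPoly e
  tail≐ = prodFrom-linear F d F≐linear (suc lo) c
  coefficient : zPoly e ⊕ zShift (d lo) (zPoly e) ≐ zPoly (elemSym (d lo ∷ xs))
  coefficient zero    zero    = ℤ.+-identityʳ _
  coefficient zero    (suc b) = refl
  coefficient (suc a) zero    = refl
  coefficient (suc a) (suc b) = trans (ℤ.+-identityˡ _) (ℤ.*-zeroʳ (d lo))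

elemSym-cong-∷ : ∀ x {xs ys} →
  elemSym xs ≗ elemSym ys → elemSym (x ∷ xs) ≗ elemSym (x ∷ ys)
elemSym-cong-∷ x eq zero    = eq zero
elemSym-cong-∷ x eq (suc b) = cong₂ (λ u v → u +ℤ x *ℤ v) (eq (suc b)) (eq b)

elemSym-∷ʳ : ∀ xs y → elemSym (xs ∷ʳ y) ≗ elemSym (y ∷ xs)
elemSym-∷ʳ []       y b             = refl
elemSym-∷ʳ (x ∷ xs) y zero          = elemSym-∷ʳ xs y zero
elemSym-∷ʳ (x ∷ xs) y (suc zero)    =
  trans (cong₂ (λ u v → u +ℤ x *ℤ v) (elemSym-∷ʳ xs y 1) (elemSym-∷ʳ xs y 0))
        (swap₁ (elemSym xs 1) (elemSym xs 0) x y)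
  where
  swap₁ : ∀ e₁ e₀ x y → (e₁ +ℤ y *ℤ e₀) +ℤ x *ℤ e₀ ≡ (e₁ +ℤ x *ℤ e₀) +ℤ y *ℤ e₀
  swap₁ = solve-∀
elemSym-∷ʳ (x ∷ xs) y (suc (suc b)) =
  trans (cong₂ (λ u v → u +ℤ x *ℤ v)
               (elemSym-∷ʳ xs y (suc (suc b))) (elemSym-∷ʳ xs y (suc b)))
        (swap₂ (elemSym xs (suc (suc b))) (elemSym xs (suc b)) (elemSym xs b) x y)
  where
  swap₂ : ∀ e₂ e₁ e₀ x y → (e₂ +ℤ y *ℤ e₁) +ℤ x *ℤ (e₁ +ℤ y *ℤ e₀)
                         ≡ (e₂ +ℤ x *ℤ e₁) +ℤ y *ℤ (e₁ +ℤ x *ℤ e₀)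
  swap₂ = solve-∀

elemSym-reverse : ∀ xs → elemSym (reverse xs) ≗ elemSym xs
elemSym-reverse []       b = refl
elemSym-reverse (x ∷ xs) b = begin
  elemSym (reverse (x ∷ xs)) b  ≡⟨ cong (λ ys → elemSym ys b) (List.unfold-reverse x xs) ⟩
  elemSym (reverse xs ∷ʳ x) b   ≡⟨ elemSym-∷ʳ (reverse xs) x b ⟩
  elemSym (x ∷ reverse xs) b    ≡⟨ elemSym-cong-∷ x (elemSym-reverse xs) b ⟩
  elemSym (x ∷ xs) b            ∎
  where open ≡-Reasoning

range-∷ʳ : ∀ lo c → range lo (suc c) ≡ range lo c ∷ʳ (lo ℕ.+ c)
range-∷ʳ lo zero    = cong (_∷ []) (sym (ℕ.+-identityʳ lo))
range-∷ʳ lo (suc c) = cong (lo ∷_) (trans (range-∷ʳ (suc lo) c)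
  (cong (range (suc lo) c ∷ʳ_) (sym (ℕ.+-suc lo c))))

reverse-range : ∀ lo c → reverse (range lo c) ≡ applyDownFrom (lo ℕ.+_) c
reverse-range lo zero    = refl
reverse-range lo (suc c) = begin
  reverse (range lo (suc c))           ≡⟨ cong reverse (range-∷ʳ lo c) ⟩
  reverse (range lo c ∷ʳ (lo ℕ.+ c))   ≡⟨ List.reverse-++ (range lo c) _ ⟩
  lo ℕ.+ c ∷ reverse (range lo c)      ≡⟨ cong (lo ℕ.+ c ∷_) (reverse-range lo c) ⟩
  applyDownFrom (lo ℕ.+_) (suc c)      ∎
  where open ≡-Reasoning

elemSym-downFrom : ∀ (f : ℕ → ℤ) lo c →
  elemSym (map f (applyDownFrom (lo ℕ.+_) c)) ≗ elemSym (map f (range lo c))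
elemSym-downFrom f lo c b = begin
  elemSym (map f (applyDownFrom (lo ℕ.+_) c)) b  ≡⟨ cong (λ js → elemSym (map f js) b)
                                                        (sym (reverse-range lo c)) ⟩
  elemSym (map f (reverse (range lo c))) b       ≡⟨ cong (λ xs → elemSym xs b)
                                                        (List.reverse-map f (range lo c)) ⟩
  elemSym (reverse (map f (range lo c))) b       ≡⟨ elemSym-reverse (map f (range lo c)) b ⟩
  elemSym (map f (range lo c)) b                 ∎
  where open ≡-Reasoning

infix 4 _≡_mod_ _≋_mod_

record _≡_mod_ (x y : ℤ) (m : ℕ) : Set where
  constructor divides-difference
  field difference : + m Signed.∣ x - y

_≋_mod_ : Poly → Poly → ℕ → Set
f ≋ g mod m = ∀ a b → f a b ≡ g a b mod m

module _ {m : ℕ} where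

  ≡-mod-refl : ∀ x → x ≡ x mod m
  ≡-mod-refl x = divides-difference (Signed.divides (+ 0) (x-x≡0 x))
    where
    x-x≡0 : ∀ x → x - x ≡ + 0
    x-x≡0 = solve-∀

  +-cong-mod : ∀ {x x′ y y′} → x ≡ x′ mod m → y ≡ y′ mod m → x +ℤ y ≡ x′ +ℤ y′ mod m
  +-cong-mod {x} {x′} {y} {y′} (divides-difference m∣x-x′) (divides-difference m∣y-y′) =
    divides-difference (subst (+ m Signed.∣_) (sym (difference-+ x y x′ y′))
      (Signed.∣m∣n⇒∣m+n m∣x-x′ m∣y-y′))
    where
    difference-+ : ∀ x y x′ y′ → (x +ℤ y) - (x′ +ℤ y′) ≡ (x - x′) +ℤ (y - y′)
    difference-+ = solve-∀

  *-cong-mod : ∀ {x x′ y y′} → x ≡ x′ mod m → y ≡ y′ mod m → x *ℤ y ≡ x′ *ℤ y′ mod m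
  *-cong-mod {x} {x′} {y} {y′} (divides-difference m∣x-x′) (divides-difference m∣y-y′) =
    divides-difference (subst (+ m Signed.∣_) (sym (difference-* x y x′ y′))
      (Signed.∣m∣n⇒∣m+n (Signed.∣n⇒∣m*n x m∣y-y′) (Signed.∣m⇒∣m*n y′ m∣x-x′)))
    where
    difference-* : ∀ x y x′ y′ → (x *ℤ y) - (x′ *ℤ y′) ≡ x *ℤ (y - y′) +ℤ (x - x′) *ℤ y′
    difference-* = solve-∀

  sumTo-cong-mod : ∀ n {h h′ : ℕ → ℤ} → (∀ i → h i ≡ h′ i mod m) →
    sumTo n h ≡ sumTo n h′ mod m
  sumTo-cong-mod zero    h≡h′ = h≡h′ 0
  sumTo-cong-mod (suc n) h≡h′ = +-cong-mod (sumTo-cong-mod n h≡h′) (h≡h′ (suc n))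

  ≋-resp-≐ : ∀ {f f′ g g′ : Poly} → f ≐ f′ → g ≐ g′ → f ≋ g mod m → f′ ≋ g′ mod m
  ≋-resp-≐ f≐f′ g≐g′ f≡g a b
    rewrite sym (f≐f′ a b) | sym (g≐g′ a b) = f≡g a b

  ⊗-congˡ-mod : ∀ (f : Poly) {g g′ : Poly} → g ≋ g′ mod m → f ⊗ g ≋ f ⊗ g′ mod m
  ⊗-congˡ-mod f g≡g′ a b = sumTo-cong-mod a λ i → sumTo-cong-mod b λ j →
    *-cong-mod (≡-mod-refl (f i j)) (g≡g′ (a ∸ i) (b ∸ j))

  sumBelow-cong-mod : ∀ n {F G : ℕ → Poly} → (∀ k → k < n → F k ≋ G k mod m) →
    sumBelow n F ≋ sumBelow n G mod m
  sumBelow-cong-mod zero    F≡G a b = ≡-mod-refl _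
  sumBelow-cong-mod (suc n) F≡G a b = +-cong-mod
    (sumBelow-cong-mod n (λ k k<n → F≡G k (ℕ.m<n⇒m<1+n k<n)) a b) (F≡G n ℕ.≤-refl a b)

  zPoly-cong-mod : ∀ {e e′ : ℕ → ℤ} → (∀ b → e b ≡ e′ b mod m) →
    zPoly e ≋ zPoly e′ mod m
  zPoly-cong-mod e≡e′ zero    b = e≡e′ b
  zPoly-cong-mod e≡e′ (suc a) b = ≡-mod-refl _

  elemSym-cong-mod : ∀ {xs ys} → Pointwise (_≡_mod m) xs ys →
    ∀ b → elemSym xs b ≡ elemSym ys b mod m
  elemSym-cong-mod []            zero    = ≡-mod-refl _
  elemSym-cong-mod []            (suc b) = ≡-mod-refl _
  elemSym-cong-mod (x≡y ∷ xs≡ys) zero    = elemSym-cong-mod xs≡ys zero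
  elemSym-cong-mod (x≡y ∷ xs≡ys) (suc b) = +-cong-mod
    (elemSym-cong-mod xs≡ys (suc b)) (*-cong-mod x≡y (elemSym-cong-mod xs≡ys b))

1-jz : ℕ → Poly
1-jz j = cst (+ 1) ⊖ cst (+ j) ⊗ Z

1+jz : ℕ → Poly
1+jz j = cst (+ 1) ⊕ cst (+ j) ⊗ Z

module _ {p N : ℕ} (p∣N : p ℕ.∣ N) where

  -range≡downFrom-mod : ∀ lo c → lo ℕ.+ c ≡ N →
    Pointwise (_≡_mod p) (map (-_ ∘ +_) (range lo c)) (map +_ (applyDownFrom suc c))
  -range≡downFrom-mod lo zero    _      = []
  -range≡downFrom-mod lo (suc c) lo+c≡N =
    -lo≡1+c ∷ -range≡downFrom-mod (suc lo) c (trans (sym (ℕ.+-suc lo c)) lo+c≡N)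
    where
    difference≡-N : - (+ lo) - + suc c ≡ - (+ N)
    difference≡-N =
      trans (sym (ℤ.neg-distrib-+ (+ lo) (+ suc c))) (cong (-_ ∘ +_) lo+c≡N)
    -lo≡1+c : - (+ lo) ≡ + suc c mod p
    -lo≡1+c = divides-difference
      (subst (+ p Signed.∣_) (sym difference≡-N) (Signed.∣m⇒∣-m (Signed.∣ᵤ⇒∣ p∣N)))

  descending≋ascending : ∀ k → k < N →
    prodFrom (suc k) (N ∸ suc k) 1-jz ≋ prodFrom 1 (N ∸ suc k) 1+jz mod p
  descending≋ascending k k<N = ≋-resp-≐
    (λ a b → sym (prodFrom-linear 1-jz (-_ ∘ +_) (1-dz≐linear ∘ +_) (suc k) c a b))
    (λ a b → sym (prodFrom-linear 1+jz +_ (1+dz≐linear ∘ +_) 1 c a b))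
    (zPoly-cong-mod λ b →
      subst (λ e → elemSym (map (-_ ∘ +_) (range (suc k) c)) b ≡ e mod p)
        (elemSym-downFrom +_ 1 c b)
        (elemSym-cong-mod (-range≡downFrom-mod (suc k) c (ℕ.m+[n∸m]≡n k<N)) b))
    where
    c = N ∸ suc k

  lhsPoly≋rhsPoly : lhsPoly N ≋ rhsPoly N mod p
  lhsPoly≋rhsPoly =
    ≋-resp-≐ (λ _ _ → refl) (λ a b → sym (sumBelow-reverse N rhsTerm a b))
      (sumBelow-cong-mod N termwise)
    where
    rhsTerm : ℕ → Poly
    rhsTerm k = pow (X ⊗ Z) (N ∸ k ∸ 1) ⊗ prodFrom 1 k 1+jz
    exponent : ∀ {k} → k < N → k ≡ N ∸ (N ∸ suc k) ∸ 1
    exponent k<N = sym (cong (_∸ 1) (ℕ.m∸[m∸n]≡n k<N))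
    termwise : ∀ k → k < N →
      pow (X ⊗ Z) k ⊗ prodFrom (suc k) (N ∸ suc k) 1-jz ≋ rhsTerm (N ∸ suc k) mod p
    termwise k k<N = ≋-resp-≐ (λ _ _ → refl)
      (λ a b → cong (λ e → (pow (X ⊗ Z) e ⊗ prodFrom 1 (N ∸ suc k) 1+jz) a b) (exponent k<N))
      (⊗-congˡ-mod (pow (X ⊗ Z) k) (descending≋ascending k k<N))

lemma3p4 : (p : ℕ) → Prime p → (n : ℕ) → 1 ≤ n →
    (a b : ℕ) → (+ p) ∣ (lhsPoly (n * p) a b - rhsPoly (n * p) a b)
lemma3p4 p _ n _ a b =
  Signed.∣⇒∣ᵤ (_≡_mod_.difference (lhsPoly≋rhsPoly (ℕ.n∣m*n n) a b))
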